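{- For every integer $n\geq 0$, the number of Fishburn permutations of length $n$ that simultaneously avoid the classical patterns $321$, $1423$ and $2143$ equals $\binom{n}{2}+1$.
   Context: A permutation of length $n$ is a rearrangement $\pi=\pi_1\cdots\pi_n$ of $[n]$ (for $n=0$ there is exactly one, the empty permutation). A permutation $\pi$ contains a classical pattern $p\in S_k$ if some subsequence of $\pi$ of length $k$ is order-isomorphic to $p$; otherwise it avoids $p$. A Fishburn permutation is a permutation $\pi$ for which there are no indices $i<j$ with $\pi_j<\pi_i<\pi_{i+1}$ and $\pi_i=\pi_j+1$. -}

module Defs where

open import Data.Nat using (ℕ; suc; _<_)
open import Data.Fin using (Fin; toℕ)
open import Data.Vec using (Vec; lookup; _∷_; [])
open import Data.Product using (Σ; ∃; _×_)
open import Relation.Binary.PropositionalEquality using (_≡_)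
open import Relation.Nullary using (¬_)

-- A word of length n over [n] (0-based values), read as π₁⋯πₙ.
Word : ℕ → Set
Word n = Vec (Fin n) n

val : ∀ {n} → Word n → Fin n → ℕ
val π i = toℕ (lookup π i)

-- π is a permutation of [n]: injective (hence bijective on Fin n)
IsPerm : ∀ {n} → Word n → Set
IsPerm {n} π = (i j : Fin n) → lookup π i ≡ lookup π j → i ≡ j

Contains : ∀ {n k} → Word n → Vec ℕ k → Set
Contains {n} {k} π p =
  Σ (Fin k → Fin n) λ f →
    ((a b : Fin k) → toℕ a < toℕ b → toℕ (f a) < toℕ (f b)) ×
    ((a b : Fin k) → (val π (f a) < val π (f b) → lookup p a < lookup p b)
                   × (lookup p a < lookup p b → val π (f a) < val π (f b)))

Avoids : ∀ {n k} → Word n → Vec ℕ k → Set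
Avoids π p = ¬ Contains π p

Fishburn : ∀ {n} → Word n → Set
Fishburn {n} π =
  ¬ (Σ (Fin n) λ i → Σ (Fin n) λ j → Σ (Fin n) λ i+1 →
       (toℕ i+1 ≡ suc (toℕ i)) × (toℕ i < toℕ j) ×
       (val π j < val π i) × (val π i < val π i+1) ×
       (val π i ≡ suc (val π j)))

p321 : Vec ℕ 3
p321 = 3 ∷ 2 ∷ 1 ∷ []

p1423 : Vec ℕ 4
p1423 = 1 ∷ 4 ∷ 2 ∷ 3 ∷ []

p2143 : Vec ℕ 4
p2143 = 2 ∷ 1 ∷ 4 ∷ 3 ∷ []

Good : ∀ {n} → Word n → Set
Good π = IsPerm π × Fishburn π × Avoids π p321 × Avoids π p1423 × Avoids π p2143

-- A permutation of length N is handled as a function v : ℕ → ℕ on [0, N), and the four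
-- forbidden configurations (the three patterns and a Fishburn pair) are listed explicitly.
-- A good permutation of length n + 1 either ends with its maximum n, and deleting it leaves a
-- good permutation of length n (appending a maximum conversely preserves goodness), or its
-- last entry ℓ is smaller. In the second case the entry ℓ + 1 is forced to be either
-- penultimate, which leaves only 0 1 ⋯ (n-2) n (n-1), or first, which leaves one of the
-- n - 1 permutations (j+2) 0 1 ⋯ j (j+3) ⋯ n (j+1); anywhere else it completes a 321, a 1423
-- or a Fishburn pair. Hence the counts satisfy a(n + 1) = a(n) + n with a(0) = 1.
module Submission where

open import Defs
open import Data.Empty using (⊥; ⊥-elim)
open import Data.Fin as Fin using (Fin; zero; suc; #_; toℕ; fromℕ<; punchOut)
open import Data.Fin.Properties using (toℕ-injective; toℕ<n; toℕ-fromℕ<; fromℕ<-toℕ; any?; all?; punchOut-injective; injective⇒≤)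
open import Data.List using (List; []; _∷_; _++_; length)
import Data.List as List
open import Data.List.Membership.Propositional using (_∈_)
open import Data.List.Membership.Propositional.Properties using (∈-tabulate⁺; ∈-tabulate⁻; ∈-map⁺; ∈-map⁻; ∈-++⁺ˡ; ∈-++⁺ʳ; ∈-++⁻)
open import Data.List.Properties using (length-tabulate; length-map; length-++)
import Data.List.Relation.Unary.All as ListAll
open import Data.List.Relation.Unary.AllPairs using ([]; _∷_)
open import Data.List.Relation.Unary.Any using (here; there)
open import Data.List.Relation.Unary.Unique.Propositional using (Unique)
open import Data.List.Relation.Unary.Unique.Propositional.Properties using (map⁺; ++⁺; tabulate⁺)
open import Data.Nat using (ℕ; zero; suc; pred; >-nonZero; _+_; _∸_; _≤_; _<_; z≤n; s≤s; z<s; s<s; _≟_; _<?_; _≤?_; s≤s⁻¹; s<s⁻¹)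
open import Data.Nat.Combinatorics using (_C_; nC1≡n; nCk+nC[k+1]≡[n+1]C[k+1])
open import Data.Nat.Properties
open import Data.Product using (Σ; ∃; ∃₂; _×_; _,_; proj₁; proj₂)
open import Data.Sum using (_⊎_; inj₁; inj₂)
open import Data.Vec using (Vec; lookup; tabulate; _∷_; []; _∷ʳ_)
import Data.Vec as Vec
open import Data.Vec.Properties using (tabulate∘lookup; tabulate-cong; lookup∘tabulate; lookup-map)
open import Data.Vec.Relation.Unary.All using (All; []; _∷_)
import Data.Vec.Relation.Unary.All.Properties as VecAll
open import Data.Vec.Relation.Unary.Linked using (Linked; []; [-]; _∷_)
import Data.Vec.Relation.Unary.Linked.Properties as Linked
open import Function using (_∘_)
open import Function.Bundles using (_⇔_; mk⇔)
open import Relation.Binary using (tri<; tri≈; tri>)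
open import Relation.Binary.PropositionalEquality using (_≡_; _≢_; refl; sym; trans; cong; cong₂; subst; subst₂; module ≡-Reasoning)
open import Relation.Nullary using (¬_; Dec; yes; no; contradiction; _×-dec_; _→-dec_)
open import Relation.Nullary.Decidable using (from-yes; True; toWitness)

record IsPermutation (N : ℕ) (v : ℕ → ℕ) : Set where
  field
    injective : ∀ {x y} → x < N → y < N → v x ≡ v y → x ≡ y
    bounded   : ∀ {x} → x < N → v x < N

AgreeBelow : ℕ → (ℕ → ℕ) → (ℕ → ℕ) → Set
AgreeBelow N v w = ∀ {x} → x < N → v x ≡ w x

module _ {N : ℕ} {v : ℕ → ℕ} (perm : IsPermutation N v) where
  open IsPermutation perm

  private
    f : Fin N → Fin N
    f i = fromℕ< (bounded (toℕ<n i))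

    toℕ-f : ∀ i → toℕ (f i) ≡ v (toℕ i)
    toℕ-f i = toℕ-fromℕ< (bounded (toℕ<n i))

    f-injective : ∀ {i j} → f i ≡ f j → i ≡ j
    f-injective {i} {j} fi≡fj = toℕ-injective
      (injective (toℕ<n i) (toℕ<n j) (trans (sym (toℕ-f i)) (trans (cong toℕ fi≡fj) (toℕ-f j))))

  -- If t were missed, punching it out of the image would inject Fin N into Fin (N ∸ 1).
  surjective : ∀ {t} → t < N → ∃ λ x → x < N × v x ≡ t
  surjective {t} t<N@(s≤s _) with any? (λ i → fromℕ< t<N Fin.≟ f i)
  ... | yes (i , t≡fi) = toℕ i , toℕ<n i , trans (sym (toℕ-f i)) (trans (cong toℕ (sym t≡fi)) (toℕ-fromℕ< t<N))
  ... | no t∉f = contradiction (injective⇒≤ g-injective) 1+n≰n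
    where
    g : Fin N → Fin (N ∸ 1)
    g i = punchOut (λ t≡fi → t∉f (i , t≡fi))
    g-injective : ∀ {i j} → g i ≡ g j → i ≡ j
    g-injective {i} {j} = f-injective ∘ punchOut-injective (λ t≡fi → t∉f (i , t≡fi)) (λ t≡fj → t∉f (j , t≡fj))

module _ {L : ℕ} {u : ℕ → ℕ} (increasing : ∀ {x y} → x < y → y < L → u x < u y)
         (bounded : ∀ {x} → x < L → u x < L) where

  private
    x≤u[x] : ∀ {x} → x < L → x ≤ u x
    x≤u[x] {zero}  _     = z≤n
    x≤u[x] {suc x} 1+x<L = ≤-<-trans (x≤u[x] (<-trans (n<1+n x) 1+x<L)) (increasing (n<1+n x) 1+x<L)

    u[x]+d≤u[x+d] : ∀ {x} d → x + d < L → u x + d ≤ u (x + d)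
    u[x]+d≤u[x+d] {x} zero    _ rewrite +-identityʳ x | +-identityʳ (u x) = ≤-refl
    u[x]+d≤u[x+d] {x} (suc d) x+1+d<L rewrite +-suc x d | +-suc (u x) d =
      ≤-<-trans (u[x]+d≤u[x+d] d (<-trans (n<1+n _) x+1+d<L)) (increasing (n<1+n _) x+1+d<L)

  increasing-self-map⇒id : ∀ {x} → x < L → u x ≡ x
  increasing-self-map⇒id {x} x<L@(s≤s {n = K} x≤K) = ≤-antisym (+-cancelʳ-≤ d (u x) x u[x]+d≤x+d) (x≤u[x] x<L)
    where
    d = K ∸ x
    x+d≡K : x + d ≡ K
    x+d≡K = m+[n∸m]≡n x≤K
    u[x]+d≤x+d : u x + d ≤ x + d
    u[x]+d≤x+d = begin
      u x + d    ≤⟨ u[x]+d≤u[x+d] d (subst (_< L) (sym x+d≡K) (n<1+n K)) ⟩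
      u (x + d)  ≡⟨ cong u x+d≡K ⟩
      u K        ≤⟨ s≤s⁻¹ (bounded (n<1+n K)) ⟩
      K          ≡⟨ sym x+d≡K ⟩
      x + d      ∎
      where open ≤-Reasoning

-- The Fishburn hypothesis π_j < π_i is omitted, being implied by π_i = π_j + 1.
data Forbidden (N : ℕ) (v : ℕ → ℕ) : Set where
  occurrence321  : ∀ {x y z} → x < y → y < z → z < N →
                   v z < v y → v y < v x → Forbidden N v
  occurrence1423 : ∀ {x y z w} → x < y → y < z → z < w → w < N →
                   v x < v z → v z < v w → v w < v y → Forbidden N v
  occurrence2143 : ∀ {x y z w} → x < y → y < z → z < w → w < N →
                   v y < v x → v x < v w → v w < v z → Forbidden N v
  fishburnPair   : ∀ {i j} → i < j → j < N → v i < v (suc i) → v i ≡ suc (v j) → Forbidden N v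

record Admissible (N : ℕ) (v : ℕ → ℕ) : Set where
  field
    isPermutation : IsPermutation N v
    avoids        : ¬ Forbidden N v
  open IsPermutation isPermutation public

Forbidden-weaken : ∀ {N v} → Forbidden N v → Forbidden (suc N) v
Forbidden-weaken (occurrence321 x<y y<z z<N h₁ h₂) = occurrence321 x<y y<z (m<n⇒m<1+n z<N) h₁ h₂
Forbidden-weaken (occurrence1423 x<y y<z z<w w<N h₁ h₂ h₃) = occurrence1423 x<y y<z z<w (m<n⇒m<1+n w<N) h₁ h₂ h₃
Forbidden-weaken (occurrence2143 x<y y<z z<w w<N h₁ h₂ h₃) = occurrence2143 x<y y<z z<w (m<n⇒m<1+n w<N) h₁ h₂ h₃
Forbidden-weaken (fishburnPair i<j j<N h₁ h₂) = fishburnPair i<j (m<n⇒m<1+n j<N) h₁ h₂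

module _ {N : ℕ} {v w : ℕ → ℕ} (v≗w : AgreeBelow N v w) where

  private
    <-transport : ∀ {a b} → a < N → b < N → v a < v b → w a < w b
    <-transport a<N b<N = subst₂ _<_ (v≗w a<N) (v≗w b<N)

  Forbidden-cong : Forbidden N v → Forbidden N w
  Forbidden-cong (occurrence321 x<y y<z z<N h₁ h₂) =
    let y<N = <-trans y<z z<N ; x<N = <-trans x<y y<N in
    occurrence321 x<y y<z z<N (<-transport z<N y<N h₁) (<-transport y<N x<N h₂)
  Forbidden-cong (occurrence1423 x<y y<z z<w w<N h₁ h₂ h₃) =
    let z<N = <-trans z<w w<N ; y<N = <-trans y<z z<N ; x<N = <-trans x<y y<N in
    occurrence1423 x<y y<z z<w w<N (<-transport x<N z<N h₁) (<-transport z<N w<N h₂) (<-transport w<N y<N h₃)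
  Forbidden-cong (occurrence2143 x<y y<z z<w w<N h₁ h₂ h₃) =
    let z<N = <-trans z<w w<N ; y<N = <-trans y<z z<N ; x<N = <-trans x<y y<N in
    occurrence2143 x<y y<z z<w w<N (<-transport y<N x<N h₁) (<-transport x<N w<N h₂) (<-transport w<N z<N h₃)
  Forbidden-cong (fishburnPair i<j j<N h₁ h₂) =
    let i<N = <-trans i<j j<N ; 1+i<N = ≤-<-trans i<j j<N in
    fishburnPair i<j j<N (<-transport i<N 1+i<N h₁) (trans (sym (v≗w i<N)) (trans h₂ (cong suc (v≗w j<N))))

AgreeBelow-sym : ∀ {N v w} → AgreeBelow N v w → AgreeBelow N w v
AgreeBelow-sym v≗w x<N = sym (v≗w x<N)

Admissible-cong : ∀ {N v w} → AgreeBelow N v w → Admissible N v → Admissible N w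
Admissible-cong {N} v≗w adm = record
  { isPermutation = record
    { injective = λ x<N y<N wx≡wy → injective x<N y<N (trans (v≗w x<N) (trans wx≡wy (sym (v≗w y<N))))
    ; bounded   = λ x<N → subst (_< N) (v≗w x<N) (bounded x<N)
    }
  ; avoids = avoids ∘ Forbidden-cong (AgreeBelow-sym v≗w)
  }
  where open Admissible adm

extendTop : ℕ → (ℕ → ℕ) → ℕ → ℕ
extendTop n v x with x <? n
... | yes _ = v x
... | no  _ = n

extendTop-< : ∀ {n v x} → x < n → extendTop n v x ≡ v x
extendTop-< {n} {v} {x} x<n with x <? n
... | yes _   = refl
... | no  x≮n = contradiction x<n x≮n

extendTop-top : ∀ {n v} → extendTop n v n ≡ n
extendTop-top {n} with n <? n
... | yes n<n = contradiction n<n (<-irrefl refl)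
... | no  _   = refl

extendTop-bounded : ∀ {n v} → (∀ {x} → x < n → v x < n) → ∀ {x} → x < suc n → extendTop n v x < suc n
extendTop-bounded {n} bounded {x} x<1+n with m<1+n⇒m<n∨m≡n x<1+n
... | inj₁ x<n  = subst (_< suc n) (sym (extendTop-< x<n)) (m<n⇒m<1+n (bounded x<n))
... | inj₂ refl = subst (_< suc n) (sym extendTop-top) (n<1+n n)

-- The last position of every forbidden configuration carries a value below an earlier one,
-- so no configuration of the extension ends at the appended maximum.
module _ {n : ℕ} {v : ℕ → ℕ} (adm : Admissible n v) where
  open Admissible adm
  private
    w = extendTop n v

    inversion-below : ∀ {x y} → x < y → y < suc n → w y < w x → y < n
    inversion-below {x} x<y y<1+n wy<wx with m<1+n⇒m<n∨m≡n y<1+n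
    ... | inj₁ y<n  = y<n
    ... | inj₂ refl = contradiction (subst₂ _<_ extendTop-top (extendTop-< x<y) wy<wx) (<⇒≯ (bounded x<y))

    lower : ∀ {a b} → a < n → b < n → w a < w b → v a < v b
    lower a<n b<n = subst₂ _<_ (extendTop-< a<n) (extendTop-< b<n)

    injective′ : ∀ {x y} → x < suc n → y < suc n → w x ≡ w y → x ≡ y
    injective′ {x} {y} x<1+n y<1+n wx≡wy with m<1+n⇒m<n∨m≡n x<1+n | m<1+n⇒m<n∨m≡n y<1+n
    ... | inj₁ x<n  | inj₁ y<n  = injective x<n y<n (trans (sym (extendTop-< x<n)) (trans wx≡wy (extendTop-< y<n)))
    ... | inj₁ x<n  | inj₂ refl = contradiction (trans (sym (extendTop-< x<n)) (trans wx≡wy extendTop-top)) (<⇒≢ (bounded x<n))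
    ... | inj₂ refl | inj₁ y<n  = contradiction (trans (sym (extendTop-< y<n)) (trans (sym wx≡wy) extendTop-top)) (<⇒≢ (bounded y<n))
    ... | inj₂ refl | inj₂ refl = refl

    avoids′ : ¬ Forbidden (suc n) w
    avoids′ (occurrence321 x<y y<z z<1+n h₁ h₂) =
      let z<n = inversion-below y<z z<1+n h₁ ; y<n = <-trans y<z z<n ; x<n = <-trans x<y y<n in
      avoids (occurrence321 x<y y<z z<n (lower z<n y<n h₁) (lower y<n x<n h₂))
    avoids′ (occurrence1423 x<y y<z z<w w<1+n h₁ h₂ h₃) =
      let w<n = inversion-below (<-trans y<z z<w) w<1+n h₃ ; z<n = <-trans z<w w<n
          y<n = <-trans y<z z<n ; x<n = <-trans x<y y<n in
      avoids (occurrence1423 x<y y<z z<w w<n (lower x<n z<n h₁) (lower z<n w<n h₂) (lower w<n y<n h₃))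
    avoids′ (occurrence2143 x<y y<z z<w w<1+n h₁ h₂ h₃) =
      let w<n = inversion-below z<w w<1+n h₃ ; z<n = <-trans z<w w<n
          y<n = <-trans y<z z<n ; x<n = <-trans x<y y<n in
      avoids (occurrence2143 x<y y<z z<w w<n (lower y<n x<n h₁) (lower x<n w<n h₂) (lower w<n z<n h₃))
    avoids′ (fishburnPair i<j j<1+n h₁ h₂) =
      let j<n = inversion-below i<j j<1+n (subst (w _ <_) (sym h₂) (n<1+n _))
          i<n = <-trans i<j j<n ; 1+i<n = ≤-<-trans i<j j<n in
      avoids (fishburnPair i<j j<n (lower i<n 1+i<n h₁)
                            (trans (sym (extendTop-< i<n)) (trans h₂ (cong suc (extendTop-< j<n)))))

  extendTop-admissible : Admissible (suc n) (extendTop n v)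
  extendTop-admissible = record
    { isPermutation = record { injective = injective′ ; bounded = extendTop-bounded bounded }
    ; avoids        = avoids′
    }

restrict-admissible : ∀ {n v} → Admissible (suc n) v → v n ≡ n → Admissible n v
restrict-admissible {n} {v} adm vn≡n = record
  { isPermutation = record
    { injective = λ x<n y<n → injective (m<n⇒m<1+n x<n) (m<n⇒m<1+n y<n)
    ; bounded   = λ {x} x<n → ≤∧≢⇒< (s≤s⁻¹ (bounded (m<n⇒m<1+n x<n)))
                    (λ vx≡n → <⇒≢ x<n (injective (m<n⇒m<1+n x<n) (n<1+n n) (trans vx≡n (sym vn≡n))))
    }
  ; avoids = avoids ∘ Forbidden-weaken
  }
  where open Admissible adm

-- In one-line notation (values 0, 1, …), E m = 0 1 ⋯ (m-1) (m+1) m.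
E : ℕ → ℕ → ℕ
E m x with x <? m | x ≟ m
... | yes _ | _     = x
... | no  _ | yes _ = suc m
... | no  _ | no  _ = m

E-< : ∀ {m x} → x < m → E m x ≡ x
E-< {m} {x} x<m with x <? m
... | yes _   = refl
... | no  x≮m = contradiction x<m x≮m

E-penultimate : ∀ {m} → E m m ≡ suc m
E-penultimate {m} with m <? m | m ≟ m
... | yes m<m | _      = contradiction m<m (<-irrefl refl)
... | no  _   | yes _  = refl
... | no  _   | no m≢m = contradiction refl m≢m

E-last : ∀ {m} → E m (suc m) ≡ m
E-last {m} with suc m <? m | suc m ≟ m
... | yes 1+m<m | _        = contradiction 1+m<m (<-asym (n<1+n m))
... | no  _     | yes 1+m≡m = contradiction 1+m≡m (>⇒≢ (n<1+n m))
... | no  _     | no  _    = refl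

data TwoFromEnd (m : ℕ) : ℕ → Set where
  initial     : ∀ {x} → x < m → TwoFromEnd m x
  penultimate : TwoFromEnd m m
  last        : TwoFromEnd m (suc m)

twoFromEnd : ∀ {m x} → x < suc (suc m) → TwoFromEnd m x
twoFromEnd x<2+m with m<1+n⇒m<n∨m≡n x<2+m
... | inj₂ refl = last
... | inj₁ x<1+m with m<1+n⇒m<n∨m≡n x<1+m
...   | inj₁ x<m  = initial x<m
...   | inj₂ refl = penultimate

module _ (m : ℕ) where
  private
    N : ℕ
    N = suc (suc m)

    E-inversion : ∀ {x y} → x < y → y < N → E m y < E m x → x ≡ m × y ≡ suc m
    E-inversion x<y y<N h with twoFromEnd {m} (<-trans x<y y<N) | twoFromEnd {m} y<N
    ... | initial x<m | initial y<m = contradiction (subst₂ _<_ (E-< y<m) (E-< x<m) h) (<-asym x<y)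
    ... | initial x<m | penultimate = contradiction (subst₂ _<_ E-penultimate (E-< x<m) h) (<-asym (m<n⇒m<1+n x<m))
    ... | initial x<m | last        = contradiction (subst₂ _<_ E-last (E-< x<m) h) (<-asym x<m)
    ... | penultimate | initial y<m = contradiction x<y (<-asym y<m)
    ... | penultimate | penultimate = contradiction x<y (<-irrefl refl)
    ... | penultimate | last        = refl , refl
    ... | last        | _           = contradiction (<-≤-trans y<N x<y) (<-irrefl refl)

    injective : ∀ {x y} → x < N → y < N → E m x ≡ E m y → x ≡ y
    injective x<N y<N Ex≡Ey with twoFromEnd {m} x<N | twoFromEnd {m} y<N
    ... | initial x<m | initial y<m = trans (sym (E-< x<m)) (trans Ex≡Ey (E-< y<m))
    ... | initial x<m | penultimate = contradiction (trans (sym (E-< x<m)) (trans Ex≡Ey E-penultimate)) (<⇒≢ (m<n⇒m<1+n x<m))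
    ... | initial x<m | last        = contradiction (trans (sym (E-< x<m)) (trans Ex≡Ey E-last)) (<⇒≢ x<m)
    ... | penultimate | initial y<m = contradiction (trans (sym (E-< y<m)) (trans (sym Ex≡Ey) E-penultimate)) (<⇒≢ (m<n⇒m<1+n y<m))
    ... | penultimate | penultimate = refl
    ... | penultimate | last        = contradiction (trans (sym E-last) (trans (sym Ex≡Ey) E-penultimate)) (<⇒≢ (n<1+n m))
    ... | last        | initial y<m = contradiction (trans (sym (E-< y<m)) (trans (sym Ex≡Ey) E-last)) (<⇒≢ y<m)
    ... | last        | penultimate = contradiction (trans (sym E-last) (trans Ex≡Ey E-penultimate)) (<⇒≢ (n<1+n m))
    ... | last        | last        = refl

    bounded : ∀ {x} → x < N → E m x < N
    bounded x<N with twoFromEnd {m} x<N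
    ... | initial x<m = subst (_< N) (sym (E-< x<m)) x<N
    ... | penultimate = subst (_< N) (sym E-penultimate) (n<1+n _)
    ... | last        = subst (_< N) (sym E-last) (<-trans (n<1+n m) (n<1+n _))

    avoids : ¬ Forbidden N (E m)
    avoids (occurrence321 x<y y<z z<N h₁ h₂)
      with E-inversion y<z z<N h₁ | E-inversion x<y (<-trans y<z z<N) h₂
    ... | refl , _ | _ , y≡1+m = contradiction y≡1+m (<⇒≢ (n<1+n m))
    avoids (occurrence1423 x<y y<z z<w w<N h₁ h₂ h₃) with E-inversion (<-trans y<z z<w) w<N h₃
    ... | refl , refl = contradiction z<w (≤⇒≯ y<z)
    avoids (occurrence2143 x<y y<z z<w w<N h₁ h₂ h₃)
      with E-inversion x<y (<-trans y<z (<-trans z<w w<N)) h₁ | E-inversion z<w w<N h₃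
    ... | refl , _ | z≡m , _ = contradiction z≡m (>⇒≢ (<-trans x<y y<z))
    avoids (fishburnPair i<j j<N h₁ h₂) with E-inversion i<j j<N (subst (_ <_) (sym h₂) (n<1+n _))
    ... | refl , refl = contradiction (subst₂ _<_ E-penultimate E-last h₁) (<-asym (n<1+n m))

  E-admissible : Admissible N (E m)
  E-admissible = record
    { isPermutation = record { injective = injective ; bounded = bounded }
    ; avoids        = avoids
    }

skipTwo : ℕ → ℕ → ℕ
skipTwo j t with t ≤? j
... | yes _ = t
... | no  _ = suc (suc t)

data SkipTwoView (j t : ℕ) : ℕ → Set where
  kept    : t ≤ j → SkipTwoView j t t
  shifted : j < t → SkipTwoView j t (suc (suc t))

skipTwoView : ∀ j t → SkipTwoView j t (skipTwo j t)
skipTwoView j t with t ≤? j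
... | yes t≤j = kept t≤j
... | no  t≰j = shifted (≰⇒> t≰j)

skipTwo-increasing : ∀ {j t u} → t < u → skipTwo j t < skipTwo j u
skipTwo-increasing {j} {t} {u} t<u with skipTwo j t | skipTwoView j t | skipTwo j u | skipTwoView j u
... | _ | kept _      | _ | kept _    = t<u
... | _ | kept _      | _ | shifted _ = m<n⇒m<1+n (m<n⇒m<1+n t<u)
... | _ | shifted j<t | _ | kept u≤j  = contradiction (<-trans j<t t<u) (≤⇒≯ u≤j)
... | _ | shifted _   | _ | shifted _ = s<s (s<s t<u)

OffGap : ℕ → ℕ → Set
OffGap j b = b < suc j ⊎ suc (suc j) < b

skipTwo-offGap : ∀ j t → OffGap j (skipTwo j t)
skipTwo-offGap j t with skipTwo j t | skipTwoView j t
... | _ | kept t≤j    = inj₁ (s≤s t≤j)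
... | _ | shifted j<t = inj₂ (s<s (s<s j<t))

skipTwo-< : ∀ {j t m} → t < m → skipTwo j t < suc (suc m)
skipTwo-< {j} {t} t<m with skipTwo j t | skipTwoView j t
... | _ | kept _    = <-trans t<m (<-trans (n<1+n _) (n<1+n _))
... | _ | shifted _ = s<s (s<s t<m)

dropTwo : ℕ → ℕ → ℕ
dropTwo j b with b ≤? j
... | yes _ = b
... | no  _ = b ∸ 2

dropTwo-small : ∀ {j b} → b < suc j → dropTwo j b ≡ b
dropTwo-small {j} {b} b<1+j with b ≤? j
... | yes _   = refl
... | no  b≰j = contradiction (s≤s⁻¹ b<1+j) b≰j

dropTwo-large : ∀ {j c} → j < c → dropTwo j (suc (suc c)) ≡ c
dropTwo-large {j} {c} j<c with suc (suc c) ≤? j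
... | yes 2+c≤j = contradiction (<-trans j<c (<-trans (n<1+n c) 2+c≤j)) (<-irrefl refl)
... | no  _     = refl

skipTwo-dropTwo : ∀ {j b} → OffGap j b → skipTwo j (dropTwo j b) ≡ b
skipTwo-dropTwo {j} {b} (inj₁ b<1+j) rewrite dropTwo-small b<1+j with skipTwo j b | skipTwoView j b
... | _ | kept _      = refl
... | _ | shifted j<b = contradiction b<1+j (≤⇒≯ j<b)
skipTwo-dropTwo {j} (inj₂ (s<s (s<s {n = c} j<c))) rewrite dropTwo-large j<c with skipTwo j c | skipTwoView j c
... | _ | kept c≤j = contradiction j<c (≤⇒≯ c≤j)
... | _ | shifted _ = refl

dropTwo-increasing : ∀ {j b c} → OffGap j b → OffGap j c → b < c → dropTwo j b < dropTwo j c
dropTwo-increasing (inj₁ b<1+j) (inj₁ c<1+j) b<c rewrite dropTwo-small b<1+j | dropTwo-small c<1+j = b<c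
dropTwo-increasing (inj₁ b<1+j) (inj₂ (s<s (s<s j<c))) _ rewrite dropTwo-small b<1+j | dropTwo-large j<c =
  ≤-<-trans (s≤s⁻¹ b<1+j) j<c
dropTwo-increasing (inj₂ 2+j<b) (inj₁ c<1+j) b<c = contradiction (<-trans 2+j<b b<c) (<-asym (<-trans c<1+j (n<1+n _)))
dropTwo-increasing (inj₂ (s<s (s<s j<b))) (inj₂ (s<s (s<s j<c))) 2+b<2+c rewrite dropTwo-large j<b | dropTwo-large j<c =
  s<s⁻¹ (s<s⁻¹ 2+b<2+c)

dropTwo-< : ∀ {j m b} → j < m → OffGap j b → b < suc (suc m) → dropTwo j b < m
dropTwo-< j<m (inj₁ b<1+j) _ rewrite dropTwo-small b<1+j = ≤-<-trans (s≤s⁻¹ b<1+j) j<m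
dropTwo-< j<m (inj₂ (s<s (s<s j<c))) b<2+m rewrite dropTwo-large j<c = s<s⁻¹ (s<s⁻¹ b<2+m)

-- In one-line notation, D j m = (j+2) 0 1 ⋯ j (j+3) ⋯ (m+1) (j+1), for j < m.
D : ℕ → ℕ → ℕ → ℕ
D j m zero    = suc (suc j)
D j m (suc t) with t <? m
... | yes _ = skipTwo j t
... | no  _ = suc j

D-middle : ∀ {j m t} → t < m → D j m (suc t) ≡ skipTwo j t
D-middle {j} {m} {t} t<m with t <? m
... | yes _   = refl
... | no  t≮m = contradiction t<m t≮m

D-last : ∀ {j} m → D j m (suc m) ≡ suc j
D-last m with m <? m
... | yes m<m = contradiction m<m (<-irrefl refl)
... | no  _   = refl

data FirstMiddleLast (m : ℕ) : ℕ → Set where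
  first  : FirstMiddleLast m 0
  middle : ∀ {t} → t < m → FirstMiddleLast m (suc t)
  last   : FirstMiddleLast m (suc m)

firstMiddleLast : ∀ {m x} → x < suc (suc m) → FirstMiddleLast m x
firstMiddleLast {m} {zero}  _         = first
firstMiddleLast {m} {suc t} 1+t<2+m with m<1+n⇒m<n∨m≡n (s<s⁻¹ 1+t<2+m)
... | inj₁ t<m  = middle t<m
... | inj₂ refl = last

module _ {j m : ℕ} (j<m : j < m) where
  private
    N : ℕ
    N = suc (suc m)

    D-inversion : ∀ {x y} → x < y → y < N → D j m y < D j m x → x ≡ 0 ⊎ y ≡ suc m
    D-inversion x<y y<N h with firstMiddleLast {m} (<-trans x<y y<N) | firstMiddleLast {m} y<N
    ... | first      | _          = inj₁ refl
    ... | _          | last       = inj₂ refl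
    ... | middle t<m | middle u<m =
      contradiction (subst₂ _<_ (D-middle u<m) (D-middle t<m) h) (<-asym (skipTwo-increasing (s<s⁻¹ x<y)))
    ... | last       | middle u<m = contradiction x<y (<-asym (s<s u<m))

    first≢middle : ∀ {t} → t < m → suc (suc j) ≢ skipTwo j t
    first≢middle {t} _ e with skipTwo-offGap j t
    ... | inj₁ s<1+j = contradiction (subst (_< suc j) (sym e) s<1+j) (<-asym (n<1+n _))
    ... | inj₂ 2+j<s = contradiction (sym e) (>⇒≢ 2+j<s)

    last≢middle : ∀ {t} → t < m → suc j ≢ skipTwo j t
    last≢middle {t} _ e with skipTwo-offGap j t
    ... | inj₁ s<1+j = contradiction (sym e) (<⇒≢ s<1+j)
    ... | inj₂ 2+j<s = contradiction (subst (suc (suc j) <_) (sym e) 2+j<s) (<-asym (n<1+n _))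

    injective : ∀ {x y} → x < N → y < N → D j m x ≡ D j m y → x ≡ y
    injective x<N y<N Dx≡Dy with firstMiddleLast {m} x<N | firstMiddleLast {m} y<N
    ... | first      | first      = refl
    ... | last       | last       = refl
    ... | first      | last       = contradiction (trans Dx≡Dy (D-last m)) (>⇒≢ (n<1+n _))
    ... | last       | first      = contradiction (trans (sym (D-last m)) Dx≡Dy) (<⇒≢ (n<1+n _))
    ... | first      | middle u<m = contradiction (trans Dx≡Dy (D-middle u<m)) (first≢middle u<m)
    ... | middle t<m | first      = contradiction (trans (sym Dx≡Dy) (D-middle t<m)) (first≢middle t<m)
    ... | last       | middle u<m = contradiction (trans (sym (D-last m)) (trans Dx≡Dy (D-middle u<m))) (last≢middle u<m)
    ... | middle t<m | last       = contradiction (trans (sym (D-last m)) (trans (sym Dx≡Dy) (D-middle t<m))) (last≢middle t<m)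
    ... | middle {t} t<m | middle {u} u<m with <-cmp t u
    ...   | tri< t<u _ _ = contradiction (trans (sym (D-middle t<m)) (trans Dx≡Dy (D-middle u<m))) (<⇒≢ (skipTwo-increasing t<u))
    ...   | tri≈ _ t≡u _ = cong suc t≡u
    ...   | tri> _ _ u<t = contradiction (trans (sym (D-middle t<m)) (trans Dx≡Dy (D-middle u<m))) (>⇒≢ (skipTwo-increasing u<t))

    bounded : ∀ {x} → x < N → D j m x < N
    bounded x<N with firstMiddleLast {m} x<N
    ... | first  = s<s (s<s j<m)
    ... | last   = subst (_< N) (sym (D-last m)) (s<s (s<s (<⇒≤ j<m)))
    ... | middle t<m = subst (_< N) (sym (D-middle t<m)) (skipTwo-< t<m)

    avoids : ¬ Forbidden N (D j m)
    avoids (occurrence321 {y = y} x<y y<z z<N h₁ h₂) with D-inversion y<z z<N h₁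
    ... | inj₁ refl = contradiction x<y λ ()
    ... | inj₂ refl with D-inversion x<y (<-trans y<z z<N) h₂
    ...   | inj₁ refl = contradiction (subst (_< D j m y) (D-last m) h₁) (≤⇒≯ (s≤s⁻¹ h₂))
    ...   | inj₂ refl = contradiction y<z (<-irrefl refl)
    avoids (occurrence1423 x<y y<z z<w w<N h₁ h₂ h₃) with D-inversion y<z (<-trans z<w w<N) (<-trans h₂ h₃)
    ... | inj₁ refl = contradiction x<y λ ()
    ... | inj₂ refl = contradiction (<-≤-trans w<N z<w) (<-irrefl refl)
    avoids (occurrence2143 x<y y<z z<w w<N h₁ h₂ h₃) with D-inversion z<w w<N h₃
    ... | inj₁ refl = contradiction y<z λ ()
    ... | inj₂ refl with D-inversion x<y (<-trans y<z (<-trans z<w w<N)) h₁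
    ...   | inj₁ refl = contradiction (subst (D j m 0 <_) (D-last m) h₂) (<-asym (n<1+n _))
    ...   | inj₂ refl = contradiction y<z (<-asym z<w)
    avoids (fishburnPair {i} i<j j<N h₁ h₂) =
      first-ascent (inversion-at-first (D-inversion i<j j<N (subst (_ <_) (sym h₂) (n<1+n _))))
      where
      first-ascent : i ≡ 0 → ⊥
      first-ascent refl = contradiction (subst (D j m 0 <_) (D-middle (≤-<-trans z≤n j<m)) h₁) (λ ())
      inversion-at-first : i ≡ 0 ⊎ _ ≡ suc m → i ≡ 0
      inversion-at-first (inj₁ i≡0)  = i≡0
      inversion-at-first (inj₂ refl) = injective (<-trans i<j j<N) z<s (trans h₂ (cong suc (D-last m)))

  D-admissible : Admissible N (D j m)
  D-admissible = record
    { isPermutation = record { injective = injective ; bounded = bounded }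
    ; avoids        = avoids
    }

-- With ℓ the last entry, the entry ℓ + 1 can only sit at position m (giving E m)
-- or at position 0 (giving D (ℓ - 1) m).
module Classification {m : ℕ} {v : ℕ → ℕ} (adm : Admissible (suc (suc m)) v) (last≢top : v (suc m) ≢ suc m) where
  open Admissible adm

  private
    N : ℕ
    N = suc (suc m)

    ℓ : ℕ
    ℓ = v (suc m)

    last<N : suc m < N
    last<N = n<1+n (suc m)

    ℓ<1+m : ℓ < suc m
    ℓ<1+m = ≤∧≢⇒< (s≤s⁻¹ (bounded last<N)) last≢top

    ascent : ∀ {x y} → x < y → y < N → ¬ v y < v x → v x < v y
    ascent {x} {y} x<y y<N no-inversion with <-cmp (v x) (v y)
    ... | tri< vx<vy _ _ = vx<vy
    ... | tri≈ _ vx≡vy _ = contradiction (injective (<-trans x<y y<N) y<N vx≡vy) (<⇒≢ x<y)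
    ... | tri> _ _ vy<vx = contradiction vy<vx no-inversion

    descent : ∀ {x y} → x < y → y < N → ¬ v x < v y → v y < v x
    descent {x} {y} x<y y<N no-ascent with <-cmp (v x) (v y)
    ... | tri< vx<vy _ _ = contradiction vx<vy no-ascent
    ... | tri≈ _ vx≡vy _ = contradiction (injective (<-trans x<y y<N) y<N vx≡vy) (<⇒≢ x<y)
    ... | tri> _ _ vy<vx = vy<vx

    above-last-ascending : ∀ {x y} → x < y → y < suc m → ℓ < v x → ℓ < v y → v x < v y
    above-last-ascending x<y y<1+m ℓ<vx ℓ<vy =
      ascent x<y (<-trans y<1+m last<N) (avoids ∘ occurrence321 x<y y<1+m last<N ℓ<vy)

    module SuccessorPenultimate (vm≡1+ℓ : v m ≡ suc ℓ) where
      ℓ≡m : ℓ ≡ m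
      ℓ≡m with surjective isPermutation last<N
      ... | r , r<N , vr≡1+m with twoFromEnd {m} r<N
      ...   | initial r<m = contradiction
                (subst₂ _<_ vr≡1+m vm≡1+ℓ (above-last-ascending r<m (n<1+n m)
                  (subst (ℓ <_) (sym vr≡1+m) ℓ<1+m) (subst (ℓ <_) (sym vm≡1+ℓ) (n<1+n ℓ))))
                (≤⇒≯ ℓ<1+m)
      ...   | penultimate = suc-injective (trans (sym vm≡1+ℓ) vr≡1+m)
      ...   | last        = contradiction vr≡1+m last≢top

      vm≡1+m : v m ≡ suc m
      vm≡1+m = trans vm≡1+ℓ (cong suc ℓ≡m)

      m<N : m < N
      m<N = <-trans (n<1+n m) last<N

      prefix-below : ∀ {x} → x < m → v x < m
      prefix-below {x} x<m = ≤∧≢⇒< (s≤s⁻¹ (≤∧≢⇒< (s≤s⁻¹ (bounded x<N)) vx≢1+m)) vx≢m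
        where
        x<N = <-trans x<m m<N
        vx≢1+m : v x ≢ suc m
        vx≢1+m vx≡1+m = <⇒≢ x<m (injective x<N m<N (trans vx≡1+m (sym vm≡1+m)))
        vx≢m : v x ≢ m
        vx≢m vx≡m = <⇒≢ (<-trans x<m (n<1+n m)) (injective x<N last<N (trans vx≡m (sym ℓ≡m)))

      prefix-ascending : ∀ {x y} → x < y → y < m → v x < v y
      prefix-ascending x<y y<m = ascent x<y (<-trans y<m m<N) λ vy<vx →
        avoids (occurrence2143 x<y y<m (n<1+n m) last<N vy<vx
                 (subst (v _ <_) (sym ℓ≡m) (prefix-below (<-trans x<y y<m)))
                 (subst₂ _<_ (sym ℓ≡m) (sym vm≡1+m) (n<1+n m)))

      agree : AgreeBelow N v (E m)
      agree x<N with twoFromEnd {m} x<N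
      ... | initial x<m = trans (increasing-self-map⇒id prefix-ascending prefix-below x<m) (sym (E-< x<m))
      ... | penultimate = trans vm≡1+m (sym E-penultimate)
      ... | last        = trans ℓ≡m (sym E-last)

    module SuccessorInPrefix {q : ℕ} (q<m : q < m) (vq≡1+ℓ : v q ≡ suc ℓ) where
      1+q<1+m : suc q < suc m
      1+q<1+m = s<s q<m

      1+q<N : suc q < N
      1+q<N = <-trans 1+q<1+m last<N

      ℓ<vq : ℓ < v q
      ℓ<vq = subst (ℓ <_) (sym vq≡1+ℓ) (n<1+n ℓ)

      next<ℓ : v (suc q) < ℓ
      next<ℓ = ≤∧≢⇒< (s≤s⁻¹ (subst (v (suc q) <_) vq≡1+ℓ next<vq)) next≢ℓ
        where
        next<vq : v (suc q) < v q
        next<vq = descent (n<1+n q) 1+q<N λ vq<next →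
          avoids (fishburnPair (<-trans q<m (n<1+n m)) last<N vq<next vq≡1+ℓ)
        next≢ℓ : v (suc q) ≢ ℓ
        next≢ℓ next≡ℓ = <⇒≢ 1+q<1+m (injective 1+q<N last<N next≡ℓ)

      earlier-above-next : ∀ {x} → x < q → v (suc q) < v x
      earlier-above-next x<q = descent (<-trans x<q (n<1+n q)) 1+q<N λ vx<next →
        avoids (occurrence1423 x<q (n<1+n q) 1+q<1+m last<N vx<next next<ℓ ℓ<vq)

      v0<v1 : 0 < q → v 0 < v 1
      v0<v1 0<q = ascent z<s 1<N λ v1<v0 → avoids (inversion v1<v0 (m≤n⇒m<n∨m≡n 0<q))
        where
        1<N : 1 < N
        1<N = ≤-<-trans 0<q (<-trans (n<1+n q) 1+q<N)
        inversion : v 1 < v 0 → 1 < q ⊎ 1 ≡ q → Forbidden N v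
        inversion v1<v0 (inj₁ 1<q) = occurrence321 z<s (<-trans 1<q (n<1+n q)) 1+q<N (earlier-above-next 1<q) v1<v0
        inversion v1<v0 (inj₂ refl) = occurrence321 z<s (<-trans (n<1+n 1) 1+q<1+m) last<N ℓ<vq v1<v0

      -- The entry π₀ - 1 lies to the right of π₀ < π₁, so the two form a Fishburn pair.
      0≮q : ¬ 0 < q
      0≮q 0<q = avoids (fishburnPair (n≢0⇒n>0 p≢0) p<N (v0<v1 0<q) v0≡1+vp)
        where
        instance
          _ = >-nonZero (≤-<-trans z≤n (earlier-above-next 0<q))
        pred[v0]<v0 : pred (v 0) < v 0
        pred[v0]<v0 = subst (pred (v 0) <_) (suc-pred (v 0)) (n<1+n _)
        below-v0 = surjective isPermutation (<-trans pred[v0]<v0 (bounded z<s))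
        p = proj₁ below-v0
        p<N = proj₁ (proj₂ below-v0)
        vp≡pred[v0] : v p ≡ pred (v 0)
        vp≡pred[v0] = proj₂ (proj₂ below-v0)
        v0≡1+vp : v 0 ≡ suc (v p)
        v0≡1+vp = trans (sym (suc-pred (v 0))) (cong suc (sym vp≡pred[v0]))
        p≢0 : p ≢ 0
        p≢0 p≡0 = <⇒≢ pred[v0]<v0 (trans (sym vp≡pred[v0]) (cong v p≡0))

    module SuccessorFirst {j : ℕ} (ℓ≡1+j : ℓ ≡ suc j) (v0≡2+j : v 0 ≡ suc (suc j)) (v1<1+j : v 1 < suc j) where
      j<m : j < m
      j<m = s<s⁻¹ (subst (_< suc m) ℓ≡1+j ℓ<1+m)

      middle<N : ∀ {t} → t < m → suc t < N
      middle<N t<m = s<s (m<n⇒m<1+n t<m)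

      middle-offGap : ∀ {t} → t < m → OffGap j (v (suc t))
      middle-offGap {t} t<m with <-cmp (v (suc t)) (suc j)
      ... | tri< small _ _ = inj₁ small
      ... | tri≈ _ v≡1+j _ = contradiction (injective (middle<N t<m) last<N (trans v≡1+j (sym ℓ≡1+j))) (<⇒≢ (s<s t<m))
      ... | tri> _ _ 1+j<v with <-cmp (v (suc t)) (suc (suc j))
      ...   | tri< v<2+j _ _ = contradiction 1+j<v (≤⇒≯ (s≤s⁻¹ v<2+j))
      ...   | tri≈ _ v≡2+j _ = contradiction (injective (middle<N t<m) z<s (trans v≡2+j (sym v0≡2+j))) λ ()
      ...   | tri> _ _ large = inj₂ large

      small-ascending : ∀ {t u} → t < u → u < m → v (suc t) < suc j → v (suc t) < v (suc u)
      small-ascending t<u u<m small = ascent (s<s t<u) (middle<N u<m) λ inversion →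
        avoids (occurrence321 z<s (s<s t<u) (middle<N u<m) inversion
                 (subst (v _ <_) (sym v0≡2+j) (<-trans small (n<1+n _))))

      -- Small and large entries ascend separately; a large entry before a small one would form a 1423
      -- with π₁ (which is small) and the last entry.
      middle-ascending : ∀ {t u} → t < u → u < m → v (suc t) < v (suc u)
      middle-ascending {t} {u} t<u u<m with middle-offGap (<-trans t<u u<m) | middle-offGap u<m
      ... | inj₁ small | _          = small-ascending t<u u<m small
      ... | inj₂ large | inj₂ large′ =
        above-last-ascending (s<s t<u) (s<s u<m) (subst (_< v _) (sym ℓ≡1+j) (<-trans (n<1+n _) large))
                                                  (subst (_< v _) (sym ℓ≡1+j) (<-trans (n<1+n _) large′))
      ... | inj₂ large | inj₁ small′ with t
      ...   | zero   = contradiction (<-trans v1<1+j (n<1+n _)) (<-asym large)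
      ...   | suc t′ = contradiction
              (occurrence1423 (s<s z<s) (s<s t<u) (s<s u<m) last<N
                 (small-ascending (≤-<-trans z≤n t<u) u<m v1<1+j) (subst (v _ <_) (sym ℓ≡1+j) small′)
                 (subst (_< v _) (sym ℓ≡1+j) (<-trans (n<1+n _) large)))
              avoids

      -- dropTwo closes the gap {j+1, j+2}, turning the middle into an increasing self-map of [0, m).
      middle-value : ∀ {t} → t < m → v (suc t) ≡ skipTwo j t
      middle-value {t} t<m = begin
        v (suc t)                          ≡⟨ sym (skipTwo-dropTwo (middle-offGap t<m)) ⟩
        skipTwo j (dropTwo j (v (suc t)))  ≡⟨ cong (skipTwo j) (increasing-self-map⇒id increasing bounded′ t<m) ⟩
        skipTwo j t                        ∎
        where
        open ≡-Reasoning
        increasing : ∀ {t u} → t < u → u < m → dropTwo j (v (suc t)) < dropTwo j (v (suc u))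
        increasing t<u u<m =
          dropTwo-increasing (middle-offGap (<-trans t<u u<m)) (middle-offGap u<m) (middle-ascending t<u u<m)
        bounded′ : ∀ {t} → t < m → dropTwo j (v (suc t)) < m
        bounded′ t<m = dropTwo-< j<m (middle-offGap t<m) (bounded (middle<N t<m))

      agree : AgreeBelow N v (D j m)
      agree x<N with firstMiddleLast {m} x<N
      ... | first      = v0≡2+j
      ... | middle t<m = trans (middle-value t<m) (sym (D-middle t<m))
      ... | last       = trans ℓ≡1+j (sym (D-last m))

  classify : AgreeBelow N v (E m) ⊎ ∃ λ j → j < m × AgreeBelow N v (D j m)
  classify with surjective isPermutation (s<s ℓ<1+m)
  ... | q , q<N , vq≡1+ℓ with twoFromEnd {m} q<N
  ...   | last              = contradiction vq≡1+ℓ (<⇒≢ (n<1+n ℓ))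
  ...   | penultimate       = inj₁ (SuccessorPenultimate.agree vq≡1+ℓ)
  ...   | initial {suc _} q<m = ⊥-elim (SuccessorInPrefix.0≮q q<m vq≡1+ℓ z<s)
  ...   | initial {zero}  0<m = inj₂ (pred ℓ , j<m , agree)
    where
    open SuccessorInPrefix 0<m vq≡1+ℓ using (next<ℓ)
    instance
      _ = >-nonZero (≤-<-trans z≤n next<ℓ)
    ℓ≡1+j : ℓ ≡ suc (pred ℓ)
    ℓ≡1+j = sym (suc-pred ℓ)
    open SuccessorFirst ℓ≡1+j (trans vq≡1+ℓ (cong suc ℓ≡1+j)) (subst (v 1 <_) ℓ≡1+j next<ℓ)

toFun : ∀ {N} → Word N → ℕ → ℕ
toFun {N} π x with x <? N
... | yes x<N = val π (fromℕ< x<N)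
... | no  _   = 0

toFun-< : ∀ {N} (π : Word N) {x} (x<N : x < N) → toFun π x ≡ val π (fromℕ< x<N)
toFun-< {N} π {x} x<N with x <? N
... | yes _   = refl
... | no  x≮N = contradiction x<N x≮N

toFun-val : ∀ {N} (π : Word N) (i : Fin N) → toFun π (toℕ i) ≡ val π i
toFun-val π i = trans (toFun-< π (toℕ<n i)) (cong (val π) (fromℕ<-toℕ i (toℕ<n i)))

toFun-bounded : ∀ {N} (π : Word N) {x} → x < N → toFun π x < N
toFun-bounded π x<N = subst (_< _) (sym (toFun-< π x<N)) (toℕ<n _)

toFun-injective : ∀ {N} (π ρ : Word N) → AgreeBelow N (toFun π) (toFun ρ) → π ≡ ρ
toFun-injective π ρ π≗ρ = begin
  π                      ≡⟨ sym (tabulate∘lookup π) ⟩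
  tabulate (lookup π)    ≡⟨ tabulate-cong lookup-agrees ⟩
  tabulate (lookup ρ)    ≡⟨ tabulate∘lookup ρ ⟩
  ρ                      ∎
  where
  open ≡-Reasoning
  lookup-agrees : ∀ i → lookup π i ≡ lookup ρ i
  lookup-agrees i = toℕ-injective (trans (sym (toFun-val π i)) (trans (π≗ρ (toℕ<n i)) (toFun-val ρ i)))

clamp : ∀ {N} → Fin N → ℕ → Fin N
clamp {N} i k with k <? N
... | yes k<N = fromℕ< k<N
... | no  _   = i

toℕ-clamp : ∀ {N} (i : Fin N) {k} → k < N → toℕ (clamp i k) ≡ k
toℕ-clamp {N} i {k} k<N with k <? N
... | yes _   = toℕ-fromℕ< k<N
... | no  k≮N = contradiction k<N k≮N

fromFun : (N : ℕ) → (ℕ → ℕ) → Word N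
fromFun N g = tabulate λ i → clamp i (g (toℕ i))

toFun-fromFun : ∀ {N g} → (∀ {x} → x < N → g x < N) → AgreeBelow N (toFun (fromFun N g)) g
toFun-fromFun {N} {g} g-bounded {x} x<N = begin
  toFun (fromFun N g) x                          ≡⟨ toFun-< (fromFun N g) x<N ⟩
  toℕ (lookup (fromFun N g) (fromℕ< x<N))        ≡⟨ cong toℕ (lookup∘tabulate _ (fromℕ< x<N)) ⟩
  toℕ (clamp (fromℕ< x<N) (g (toℕ (fromℕ< x<N)))) ≡⟨ cong (λ y → toℕ (clamp (fromℕ< x<N) (g y))) (toℕ-fromℕ< x<N) ⟩
  toℕ (clamp (fromℕ< x<N) (g x))                 ≡⟨ toℕ-clamp (fromℕ< x<N) (g-bounded x<N) ⟩
  g x                                            ∎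
  where open ≡-Reasoning

-- order lists the indices of p by increasing value.
PatternOrder : ∀ {k} → Vec ℕ k → Vec (Fin k) k → Set
PatternOrder p order =
  (∀ a b → lookup p a ≡ lookup p b → a ≡ b) ×
  (∀ a b → lookup p a < lookup p b → ∃₂ λ i j → i Fin.< j × lookup order i ≡ a × lookup order j ≡ b)

patternOrder? : ∀ {k} (p : Vec ℕ k) (order : Vec (Fin k) k) → Dec (PatternOrder p order)
patternOrder? p order =
  (all? λ a → all? λ b → (lookup p a ≟ lookup p b) →-dec (a Fin.≟ b)) ×-dec
  (all? λ a → all? λ b → (lookup p a <? lookup p b) →-dec
    any? λ i → any? λ j → (i Fin.<? j) ×-dec (lookup order i Fin.≟ a) ×-dec (lookup order j Fin.≟ b))

order321 : Vec (Fin 3) 3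
order321 = # 2 ∷ # 1 ∷ # 0 ∷ []

order1423 : Vec (Fin 4) 4
order1423 = # 0 ∷ # 2 ∷ # 3 ∷ # 1 ∷ []

order2143 : Vec (Fin 4) 4
order2143 = # 1 ∷ # 0 ∷ # 3 ∷ # 2 ∷ []

patternOrder321 : PatternOrder p321 order321
patternOrder321 = from-yes (patternOrder? p321 order321)

patternOrder1423 : PatternOrder p1423 order1423
patternOrder1423 = from-yes (patternOrder? p1423 order1423)

patternOrder2143 : PatternOrder p2143 order2143
patternOrder2143 = from-yes (patternOrder? p2143 order2143)

positions-split : ∀ {N k} {ps : Vec ℕ k} → Linked _<_ (ps ∷ʳ N) → Linked _<_ ps × All (_< N) ps
positions-split {ps = []}             _                = [] , []
positions-split {ps = x ∷ []}         (x<N ∷ [-])       = [-] , x<N ∷ []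
positions-split {ps = x ∷ y ∷ ys}     (x<y ∷ rest)      with positions-split {ps = y ∷ ys} rest
... | ascending , y<N ∷ bounded = x<y ∷ ascending , <-trans x<y y<N ∷ y<N ∷ bounded

contains-intro : ∀ {N k} (π : Word N) (p : Vec ℕ k) (order : Vec (Fin k) k) → PatternOrder p order →
                 (ps : Vec ℕ k) → Linked _<_ (ps ∷ʳ N) → Linked _<_ (Vec.map (toFun π ∘ lookup ps) order) →
                 Contains π p
contains-intro {N} {k} π p order (p-injective , sorted) ps positions values =
  f , f-increasing , λ a b → reflect a b , preserve a b
  where
  ascending = proj₁ (positions-split positions)
  bounded   = proj₂ (positions-split positions)

  f : Fin k → Fin N
  f a = fromℕ< (VecAll.lookup⁺ bounded a)

  val-f : ∀ a → val π (f a) ≡ toFun π (lookup ps a)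
  val-f a = trans (sym (toFun-val π (f a))) (cong (toFun π) (toℕ-fromℕ< _))

  f-increasing : ∀ a b → toℕ a < toℕ b → toℕ (f a) < toℕ (f b)
  f-increasing a b a<b = subst₂ _<_ (sym (toℕ-fromℕ< _)) (sym (toℕ-fromℕ< _)) (Linked.lookup⁺ <-trans ascending a<b)

  preserve : ∀ a b → lookup p a < lookup p b → val π (f a) < val π (f b)
  preserve a b pa<pb with sorted a b pa<pb
  ... | i , j , i<j , refl , refl = subst₂ _<_ (trans (lookup-map i _ order) (sym (val-f _)))
                                              (trans (lookup-map j _ order) (sym (val-f _)))
                                              (Linked.lookup⁺ <-trans values i<j)

  reflect : ∀ a b → val π (f a) < val π (f b) → lookup p a < lookup p b
  reflect a b fa<fb with <-cmp (lookup p a) (lookup p b)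
  ... | tri< pa<pb _ _ = pa<pb
  ... | tri≈ _ pa≡pb _ =
    contradiction (subst (λ c → val π (f a) < val π (f c)) (sym (p-injective a b pa≡pb)) fa<fb) (<-irrefl refl)
  ... | tri> _ _ pb<pa = contradiction (preserve b a pb<pa) (<-asym fa<fb)

module Occurrence {N k} (π : Word N) (p : Vec ℕ k) (c : Contains π p) where
  position : Fin k → ℕ
  position a = toℕ (proj₁ c a)

  position-< : ∀ a b → toℕ a < toℕ b → position a < position b
  position-< = proj₁ (proj₂ c)

  position-bounded : ∀ a → position a < N
  position-bounded a = toℕ<n (proj₁ c a)

  value-< : ∀ a b → lookup p a < lookup p b → toFun π (position a) < toFun π (position b)
  value-< a b pa<pb = subst₂ _<_ (sym (toFun-val π _)) (sym (toFun-val π _)) (proj₂ (proj₂ (proj₂ c) a b) pa<pb)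

<-by-computation : ∀ {m n} {m<n : True (m <? n)} → m < n
<-by-computation {m<n = m<n} = toWitness m<n

Good⇒Admissible : ∀ {N} {π : Word N} → Good π → Admissible N (toFun π)
Good⇒Admissible {N} {π} (perm , fishburn , avoids321 , avoids1423 , avoids2143) = record
  { isPermutation = record { injective = injective ; bounded = toFun-bounded π }
  ; avoids        = avoids
  }
  where
  injective : ∀ {x y} → x < N → y < N → toFun π x ≡ toFun π y → x ≡ y
  injective x<N y<N πx≡πy = begin
    _                    ≡⟨ sym (toℕ-fromℕ< x<N) ⟩
    toℕ (fromℕ< x<N)     ≡⟨ cong toℕ (perm _ _ (toℕ-injective (trans (sym (toFun-< π x<N)) (trans πx≡πy (toFun-< π y<N))))) ⟩
    toℕ (fromℕ< y<N)     ≡⟨ toℕ-fromℕ< y<N ⟩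
    _                    ∎
    where open ≡-Reasoning

  avoids : ¬ Forbidden N (toFun π)
  avoids (occurrence321 {x} {y} {z} x<y y<z z<N h₁ h₂) = avoids321
    (contains-intro π p321 order321 patternOrder321 (x ∷ y ∷ z ∷ []) (x<y ∷ y<z ∷ z<N ∷ [-]) (h₁ ∷ h₂ ∷ [-]))
  avoids (occurrence1423 {x} {y} {z} {w} x<y y<z z<w w<N h₁ h₂ h₃) = avoids1423
    (contains-intro π p1423 order1423 patternOrder1423 (x ∷ y ∷ z ∷ w ∷ [])
      (x<y ∷ y<z ∷ z<w ∷ w<N ∷ [-]) (h₁ ∷ h₂ ∷ h₃ ∷ [-]))
  avoids (occurrence2143 {x} {y} {z} {w} x<y y<z z<w w<N h₁ h₂ h₃) = avoids2143
    (contains-intro π p2143 order2143 patternOrder2143 (x ∷ y ∷ z ∷ w ∷ [])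
      (x<y ∷ y<z ∷ z<w ∷ w<N ∷ [-]) (h₁ ∷ h₂ ∷ h₃ ∷ [-]))
  avoids (fishburnPair {i} {j} i<j j<N h₁ h₂) = fishburn
    ( fromℕ< i<N , fromℕ< j<N , fromℕ< 1+i<N
    , trans (toℕ-fromℕ< 1+i<N) (cong suc (sym (toℕ-fromℕ< i<N)))
    , subst₂ _<_ (sym (toℕ-fromℕ< i<N)) (sym (toℕ-fromℕ< j<N)) i<j
    , subst (_< val π (fromℕ< i<N)) (toFun-< π j<N) (subst (toFun π j <_) (trans (sym h₂) (toFun-< π i<N)) (n<1+n _))
    , subst₂ _<_ (toFun-< π i<N) (toFun-< π 1+i<N) h₁
    , trans (sym (toFun-< π i<N)) (trans h₂ (cong suc (toFun-< π j<N)))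
    )
    where
    i<N = <-trans i<j j<N
    1+i<N = ≤-<-trans i<j j<N

Admissible⇒Good : ∀ {N} {π : Word N} → Admissible N (toFun π) → Good π
Admissible⇒Good {N} {π} adm = perm , fishburn , avoids ∘ forbidden321 , avoids ∘ forbidden1423 , avoids ∘ forbidden2143
  where
  open Admissible adm

  perm : IsPerm π
  perm i j πi≡πj = toℕ-injective (injective (toℕ<n i) (toℕ<n j)
    (trans (toFun-val π i) (trans (cong toℕ πi≡πj) (sym (toFun-val π j)))))

  fishburn : Fishburn π
  fishburn (i , j , i+1 , i+1≡1+i , i<j , _ , h₁ , h₂) = avoids (fishburnPair i<j (toℕ<n j)
    (subst₂ _<_ (sym (toFun-val π i)) (trans (sym (toFun-val π i+1)) (cong (toFun π) i+1≡1+i)) h₁)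
    (trans (toFun-val π i) (trans h₂ (cong suc (sym (toFun-val π j))))))

  forbidden321 : Contains π p321 → Forbidden N (toFun π)
  forbidden321 c = occurrence321 (position-< (# 0) (# 1) <-by-computation) (position-< (# 1) (# 2) <-by-computation)
    (position-bounded (# 2)) (value-< (# 2) (# 1) <-by-computation) (value-< (# 1) (# 0) <-by-computation)
    where open Occurrence π p321 c

  forbidden1423 : Contains π p1423 → Forbidden N (toFun π)
  forbidden1423 c = occurrence1423 (position-< (# 0) (# 1) <-by-computation) (position-< (# 1) (# 2) <-by-computation)
    (position-< (# 2) (# 3) <-by-computation) (position-bounded (# 3))
    (value-< (# 0) (# 2) <-by-computation) (value-< (# 2) (# 3) <-by-computation) (value-< (# 3) (# 1) <-by-computation)
    where open Occurrence π p1423 c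

  forbidden2143 : Contains π p2143 → Forbidden N (toFun π)
  forbidden2143 c = occurrence2143 (position-< (# 0) (# 1) <-by-computation) (position-< (# 1) (# 2) <-by-computation)
    (position-< (# 2) (# 3) <-by-computation) (position-bounded (# 3))
    (value-< (# 1) (# 0) <-by-computation) (value-< (# 0) (# 3) <-by-computation) (value-< (# 3) (# 2) <-by-computation)
    where open Occurrence π p2143 c

appendTop : ∀ {n} → Word n → Word (suc n)
appendTop {n} σ = fromFun (suc n) (extendTop n (toFun σ))

toFun-appendTop : ∀ {n} (σ : Word n) → AgreeBelow (suc n) (toFun (appendTop σ)) (extendTop n (toFun σ))
toFun-appendTop σ = toFun-fromFun (extendTop-bounded (toFun-bounded σ))

appendTop-last : ∀ {n} (σ : Word n) → toFun (appendTop σ) n ≡ n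
appendTop-last {n} σ = trans (toFun-appendTop σ (n<1+n n)) extendTop-top

appendTop-injective : ∀ {n} {σ ρ : Word n} → appendTop σ ≡ appendTop ρ → σ ≡ ρ
appendTop-injective {n} {σ} {ρ} eq = toFun-injective σ ρ λ {x} x<n → begin
  toFun σ x                        ≡⟨ sym (extendTop-< x<n) ⟩
  extendTop n (toFun σ) x          ≡⟨ sym (toFun-appendTop σ (m<n⇒m<1+n x<n)) ⟩
  toFun (appendTop σ) x            ≡⟨ cong (λ π → toFun π x) eq ⟩
  toFun (appendTop ρ) x            ≡⟨ toFun-appendTop ρ (m<n⇒m<1+n x<n) ⟩
  extendTop n (toFun ρ) x          ≡⟨ extendTop-< x<n ⟩
  toFun ρ x                        ∎
  where open ≡-Reasoning

appendTop-good : ∀ {n} {σ : Word n} → Good σ → Good (appendTop σ)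
appendTop-good {σ = σ} =
  Admissible⇒Good ∘ Admissible-cong (AgreeBelow-sym (toFun-appendTop σ)) ∘ extendTop-admissible ∘ Good⇒Admissible

wordE : ∀ m → Word (suc (suc m))
wordE m = fromFun _ (E m)

toFun-wordE : ∀ m → AgreeBelow (suc (suc m)) (toFun (wordE m)) (E m)
toFun-wordE m = toFun-fromFun (IsPermutation.bounded (Admissible.isPermutation (E-admissible m)))

wordD : ∀ m → Fin m → Word (suc (suc m))
wordD m j = fromFun _ (D (toℕ j) m)

toFun-wordD : ∀ m j → AgreeBelow (suc (suc m)) (toFun (wordD m j)) (D (toℕ j) m)
toFun-wordD m j = toFun-fromFun (IsPermutation.bounded (Admissible.isPermutation (D-admissible (toℕ<n j))))

newWords : ∀ n → List (Word (suc n))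
newWords zero    = []
newWords (suc m) = wordE m ∷ List.tabulate (wordD m)

newWords-good : ∀ {n π} → π ∈ newWords n → Good π
newWords-good {suc m} (here refl) = Admissible⇒Good (Admissible-cong (AgreeBelow-sym (toFun-wordE m)) (E-admissible m))
newWords-good {suc m} (there π∈D) with ∈-tabulate⁻ π∈D
... | j , refl = Admissible⇒Good (Admissible-cong (AgreeBelow-sym (toFun-wordD m j)) (D-admissible (toℕ<n j)))

newWords-last : ∀ {n π} → π ∈ newWords n → toFun π n ≢ n
newWords-last {suc m} (here refl) last≡1+m = <⇒≢ (n<1+n m) (trans (sym E-last) (trans (sym (toFun-wordE m (n<1+n _))) last≡1+m))
newWords-last {suc m} (there π∈D) last≡1+m with ∈-tabulate⁻ π∈D
... | j , refl = <⇒≢ (s<s (toℕ<n j)) (trans (sym (D-last m)) (trans (sym (toFun-wordD m j (n<1+n _))) last≡1+m))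

newWords-unique : ∀ n → Unique (newWords n)
newWords-unique zero    = []
newWords-unique (suc m) = ListAll.tabulate E≢D ∷ tabulate⁺ wordD-injective
  where
  wordD-first : ∀ j → toFun (wordD m j) 0 ≡ suc (suc (toℕ j))
  wordD-first j = toFun-wordD m j z<s
  wordD-injective : ∀ {i j} → wordD m i ≡ wordD m j → i ≡ j
  wordD-injective {i} {j} eq = toℕ-injective (suc-injective (suc-injective
    (trans (sym (wordD-first i)) (trans (cong (λ π → toFun π 0) eq) (wordD-first j)))))
  E≢D : ∀ {π} → π ∈ List.tabulate (wordD m) → wordE m ≢ π
  E≢D π∈D eq with ∈-tabulate⁻ π∈D
  ... | j , refl = 0≢1+n (trans (sym (trans (toFun-wordE m z<s) (E-< (≤-<-trans z≤n (toℕ<n j)))))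
                               (trans (cong (λ π → toFun π 0) eq) (wordD-first j)))

newWords-complete : ∀ {n} (π : Word (suc n)) → Admissible (suc n) (toFun π) → toFun π n ≢ n → π ∈ newWords n
newWords-complete {zero}  π adm last≢0 = contradiction (n<1⇒n≡0 (toFun-bounded π z<s)) last≢0
newWords-complete {suc m} π adm last≢top with Classification.classify adm last≢top
... | inj₁ π≗E = here (toFun-injective π (wordE m) λ x<N → trans (π≗E x<N) (sym (toFun-wordE m x<N)))
... | inj₂ (j , j<m , π≗D) = there (subst (_∈ List.tabulate (wordD m)) (sym π≡D) (∈-tabulate⁺ (fromℕ< j<m)))
  where
  π≡D : π ≡ wordD m (fromℕ< j<m)
  π≡D = toFun-injective π (wordD m (fromℕ< j<m)) λ {x} x<N →
    trans (π≗D x<N) (trans (cong (λ i → D i m x) (sym (toℕ-fromℕ< j<m))) (sym (toFun-wordD m (fromℕ< j<m) x<N)))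

length-newWords : ∀ n → length (newWords n) ≡ n
length-newWords zero    = refl
length-newWords (suc m) = cong suc (length-tabulate (wordD m))

goodWords : ∀ n → List (Word n)
goodWords zero    = [] ∷ []
goodWords (suc n) = List.map appendTop (goodWords n) ++ newWords n

Admissible-empty : ∀ {v} → Admissible 0 v
Admissible-empty = record
  { isPermutation = record { injective = λ () ; bounded = λ () }
  ; avoids        = λ { (occurrence321 _ _ () _ _) ; (occurrence1423 _ _ _ () _ _ _)
                      ; (occurrence2143 _ _ _ () _ _ _) ; (fishburnPair _ () _ _) }
  }

goodWords-unique : ∀ n → Unique (goodWords n)
goodWords-unique zero    = ListAll.[] ∷ []
goodWords-unique (suc n) = ++⁺ (map⁺ appendTop-injective (goodWords-unique n)) (newWords-unique n) disjoint
  where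
  disjoint : ∀ {π} → ¬ (π ∈ List.map appendTop (goodWords n) × π ∈ newWords n)
  disjoint (π∈old , π∈new) with ∈-map⁻ appendTop π∈old
  ... | σ , _ , refl = newWords-last π∈new (appendTop-last σ)

goodWords-sound : ∀ n {π} → π ∈ goodWords n → Good π
goodWords-sound zero    (here refl) = Admissible⇒Good {π = []} Admissible-empty
goodWords-sound (suc n) π∈ with ∈-++⁻ (List.map appendTop (goodWords n)) π∈
... | inj₂ π∈new = newWords-good π∈new
... | inj₁ π∈old with ∈-map⁻ appendTop π∈old
...   | σ , σ∈ , refl = appendTop-good (goodWords-sound n σ∈)

goodWords-complete : ∀ n (π : Word n) → Good π → π ∈ goodWords n
goodWords-complete zero    []  _    = here refl
goodWords-complete (suc n) π good with toFun π n ≟ n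
... | no  last≢top = ∈-++⁺ʳ (List.map appendTop (goodWords n)) (newWords-complete π adm last≢top)
  where adm = Good⇒Admissible good
... | yes last≡top = subst (_∈ goodWords (suc n)) (sym π≡appendTop[σ])
                       (∈-++⁺ˡ (∈-map⁺ appendTop (goodWords-complete n σ σ-good)))
  where
  restricted = restrict-admissible (Good⇒Admissible good) last≡top
  σ = fromFun n (toFun π)
  σ≗π : AgreeBelow n (toFun σ) (toFun π)
  σ≗π = toFun-fromFun (Admissible.bounded restricted)
  σ-good : Good σ
  σ-good = Admissible⇒Good (Admissible-cong (AgreeBelow-sym σ≗π) restricted)
  π≗appendTop[σ] : AgreeBelow (suc n) (toFun π) (toFun (appendTop σ))
  π≗appendTop[σ] {x} x<1+n with m<1+n⇒m<n∨m≡n x<1+n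
  ... | inj₁ x<n  = trans (sym (σ≗π x<n)) (trans (sym (extendTop-< x<n)) (sym (toFun-appendTop σ x<1+n)))
  ... | inj₂ refl = trans last≡top (sym (appendTop-last σ))
  π≡appendTop[σ] : π ≡ appendTop σ
  π≡appendTop[σ] = toFun-injective π (appendTop σ) π≗appendTop[σ]

nC2+1+n≡[1+n]C2+1 : ∀ n → n C 2 + 1 + n ≡ suc n C 2 + 1
nC2+1+n≡[1+n]C2+1 n = begin
  n C 2 + 1 + n      ≡⟨ +-assoc (n C 2) 1 n ⟩
  n C 2 + suc n      ≡⟨ +-suc (n C 2) n ⟩
  suc (n C 2 + n)    ≡⟨ cong suc (+-comm (n C 2) n) ⟩
  suc (n + n C 2)    ≡⟨ cong (λ k → suc (k + n C 2)) (sym (nC1≡n n)) ⟩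
  suc (n C 1 + n C 2) ≡⟨ cong suc (nCk+nC[k+1]≡[n+1]C[k+1] n 1) ⟩
  suc (suc n C 2)    ≡⟨ +-comm 1 (suc n C 2) ⟩
  suc n C 2 + 1      ∎
  where open ≡-Reasoning

length-goodWords : ∀ n → length (goodWords n) ≡ n C 2 + 1
length-goodWords zero    = refl
length-goodWords (suc n) = begin
  length (List.map appendTop (goodWords n) ++ newWords n)         ≡⟨ length-++ (List.map appendTop (goodWords n)) ⟩
  length (List.map appendTop (goodWords n)) + length (newWords n) ≡⟨ cong₂ _+_ (length-map appendTop (goodWords n))
                                                                                (length-newWords n) ⟩
  length (goodWords n) + n                                        ≡⟨ cong (_+ n) (length-goodWords n) ⟩
  n C 2 + 1 + n                                                   ≡⟨ nC2+1+n≡[1+n]C2+1 n ⟩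
  suc n C 2 + 1                                                   ∎
  where open ≡-Reasoning

theorem3p1 : (n : ℕ) →
    Σ (List (Word n)) λ L →
      Unique L × ((π : Word n) → (π ∈ L) ⇔ Good π) × (length L ≡ n C 2 + 1)
theorem3p1 n =
  goodWords n ,
  goodWords-unique n ,
  (λ π → mk⇔ (goodWords-sound n) (goodWords-complete n π)) ,
  length-goodWords n
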